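{- Let $n\in\mathbb{N}_0$, $T\in\mathfrak{R}$ and $G\in\mathfrak{T}^h_{a,n}$ with $h_G=h_T=n$. Then $\mathcal{S}(G,T)=\mathcal{J}^{\mathcal{L}(G)}_{G,T}(\rho)$ for every $\rho\in\mathcal{S}(G,T)$.
   Context: A digraph $G=(V(G),A(G))$ has finite nonempty vertex set and arc set $A(G)\subseteq V(G)\times V(G)$; $vw$ denotes $(v,w)$; $G^*$ is $G$ with loops removed. $\mathfrak{D}_r$: reflexive digraphs; $\mathfrak{T}_a$: digraphs with $G^*$ acyclic. $\mathcal{H}(G,H)$: homomorphisms; $\mathcal{S}(G,H)=\mathcal{H}(G,H)\cap\mathcal{H}(G^*,H^*)$. Subgraph $L\subseteq G$: $V(L)\subseteq V(G)$, $A(L)\subseteq A(G)$; $\xi|_L$ restriction to $V(L)$. A path is a sequence $P_0,\dots,P_{\ell(P)}$ of distinct vertices with $P_{i-1}P_i\in A(G)$ (in $G\in\mathfrak{T}_a$ identified with its vertex set). $h_G$: largest path length; $\mathcal{P}^h_G$: paths of length $h_G$; $P_\times$: digraph with vertex set $P$ and arcs $P_{i-1}P_i$; $\mathcal{L}(G)=\{P_\times:P\in\mathcal{P}^h_G\}$. $\mathfrak{T}^h_{a,n}$: the $G\in\mathfrak{T}_a$ of height $n$ in which every vertex lies on a path of length $n$. $[v,w]_H=\{u:vu,uw\in A(H)\}$, $\iota(v,w)_H=\#[v,w]_H$; for $\xi\in\mathcal{H}(G,H)$, $\iota_\xi(v,w)=\iota(\xi(v),\xi(w))_H$, $\iota_{\xi,B}$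 its restriction to $B$, $\mu_\xi(L)=\sum_{vw\in A(L^*)}\iota_\xi(v,w)$. $\mathcal{M}(L,H)$: maximizers of $\mu_\xi(L)$ over $\mathcal{H}(L,H)$; $\mathcal{M}^{\mathcal{L}}(G,H)=\{\xi\in\mathcal{H}(G,H):\xi|_L\in\mathcal{M}(L,H)\ \forall L\in\mathcal{L}\}$; $\mathcal{J}^{\mathcal{L}}_{G,H}(\rho)=\{\tau\in\mathcal{H}(G,H):\iota_{\tau,A(L^*)}=\iota_{\rho,A(L^*)}\ \forall L\in\mathcal{L}\}$. $\mathfrak{R}$: the class of $R\in\mathfrak{T}_a\cap\mathfrak{D}_r$ with $\mathcal{M}^{\mathcal{L}(R)}(R,R)\cap\mathcal{S}(R,R)\ne\emptyset$. -}

module Defs where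

open import Data.Nat using (ℕ; zero; suc; _+_; _≤_; _≥_)
open import Data.Fin using (Fin; inject₁; fromℕ) renaming (zero to fzero; suc to fsuc)
open import Data.Bool using (Bool; true; false; _∧_; if_then_else_)
open import Data.List using (List; map; allFin)
open import Data.Nat.ListAction using (sum)
open import Data.Product using (Σ; _×_; _,_; ∃)
open import Relation.Binary.PropositionalEquality using (_≡_; _≢_)
open import Relation.Nullary using (¬_)
open import Function.Definitions using (Injective)

record Digraph : Set where
  field
    pred : ℕ
    arc  : Fin (suc pred) → Fin (suc pred) → Bool

open Digraph public

V : Digraph → Set
V G = Fin (suc (pred G))

Arc : (G : Digraph) → V G → V G → Set
Arc G v w = arc G v w ≡ true

-- vw ∈ A(G*)  (G with loops removed)
Arc* : (G : Digraph) → V G → V G → Set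
Arc* G v w = Arc G v w × v ≢ w

Reflexive : Digraph → Set
Reflexive G = ∀ v → Arc G v v

record Cycle* (G : Digraph) : Set where
  field
    k     : ℕ
    c     : Fin (suc (suc k)) → V G
    steps : ∀ (i : Fin (suc k)) → Arc* G (c (inject₁ i)) (c (fsuc i))
    close : c fzero ≡ c (fromℕ (suc k))

Acyclic : Digraph → Set
Acyclic G = ¬ Cycle* G

IsHom : (G H : Digraph) → (V G → V H) → Set
IsHom G H ξ = ∀ v w → Arc G v w → Arc H (ξ v) (ξ w)

IsHom* : (G H : Digraph) → (V G → V H) → Set
IsHom* G H ξ = ∀ v w → Arc* G v w → Arc* H (ξ v) (ξ w)

IsS : (G H : Digraph) → (V G → V H) → Set
IsS G H ξ = IsHom G H ξ × IsHom* G H ξ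

record Path (G : Digraph) (ℓ : ℕ) : Set where
  field
    P     : Fin (suc ℓ) → V G
    inj   : Injective _≡_ _≡_ P
    steps : ∀ (i : Fin ℓ) → Arc G (P (inject₁ i)) (P (fsuc i))

open Path public

HeightIs : Digraph → ℕ → Set
HeightIs G h = Path G h × (∀ ℓ → Path G ℓ → ℓ ≤ h)

InTah : ℕ → Digraph → Set
InTah n G = Acyclic G × HeightIs G n
          × (∀ v → Σ (Path G n) λ p → Σ (Fin (suc n)) λ i → P p i ≡ v)

ι : (H : Digraph) → V H → V H → ℕ
ι H v w = sum (map (λ u → if arc H v u ∧ arc H u w then 1 else 0) (allFin (suc (pred H))))

-- A homomorphism ψ ∈ ℋ(P_×, H) for a path P of length ℓ, described by the
-- images ψ(P_i) of the (distinct) vertices P_0,…,P_ℓ; arcs of P_× are P_{i-1}P_i.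
IsPathHom : (H : Digraph) (ℓ : ℕ) → (Fin (suc ℓ) → V H) → Set
IsPathHom H ℓ ψ = ∀ (i : Fin ℓ) → Arc H (ψ (inject₁ i)) (ψ (fsuc i))

-- μ_ψ(P_×) = Σ_{i} ι(ψ(P_{i-1}), ψ(P_i))   (A(P_×^*) = {P_{i-1}P_i})
μ : (H : Digraph) (ℓ : ℕ) → (Fin (suc ℓ) → V H) → ℕ
μ H ℓ ψ = sum (map (λ (i : Fin ℓ) → ι H (ψ (inject₁ i)) (ψ (fsuc i))) (allFin ℓ))

RestrMax : (G H : Digraph) {ℓ : ℕ} → Path G ℓ → (V G → V H) → Set
RestrMax G H {ℓ} p ξ =
  IsPathHom H ℓ (λ i → ξ (P p i)) ×
  (∀ (ψ : Fin (suc ℓ) → V H) → IsPathHom H ℓ ψ → μ H ℓ ψ ≤ μ H ℓ (λ i → ξ (P p i)))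

-- ξ ∈ ℳ^{ℒ(G)}(G,H), where h = h_G (so ℒ(G) = {P_× : P path of length h})
IsML : (G H : Digraph) (h : ℕ) → (V G → V H) → Set
IsML G H h ξ = IsHom G H ξ × (∀ (p : Path G h) → RestrMax G H p ξ)

-- τ ∈ 𝒥^{ℒ(G)}_{G,H}(ρ), where h = h_G
InJ : (G H : Digraph) (h : ℕ) → (ρ τ : V G → V H) → Set
InJ G H h ρ τ = IsHom G H τ ×
  (∀ (p : Path G h) (i : Fin h) →
     ι H (τ (P p (inject₁ i))) (τ (P p (fsuc i))) ≡ ι H (ρ (P p (inject₁ i))) (ρ (P p (fsuc i))))

-- R ∈ 𝔑, where h = h_R
InR : (h : ℕ) → Digraph → Set
InR h R = Acyclic R × Reflexive R × ∃ λ ξ → IsML R R h ξ × IsS R R ξ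

-- In an acyclic digraph every walk of non-loop arcs is a path, so in G and T
-- such walks have length ≤ n.
--   * Counting: in a reflexive acyclic T, ι(t,t) = 1, and ι(a,b) = 2 for an arc ab of T*
--     admitting no vertex strictly between a and b.
--   * If σ ∈ ℋ(G*,T*), σ maps a path of length n in G to a walk of length n in T*; a vertex
--     strictly between the ends of one of its arcs would give a walk of length n+1.  Hence
--     ι = 2 along all arcs of all longest paths, for every σ ∈ 𝒮(G,T); this gives 𝒮 ⊆ 𝒥(ρ).
--   * Conversely let τ ∈ 𝒥(ρ).  Then ι = 2 on longest-path arcs, so (as ι(t,t) = 1) τ maps
--     them to non-loops and longest paths become walks of length n in T*.  If τ collapsed an
--     arc vw of G*, with v at position i of a longest path p and w at position j of a longest
--     path q, the walk p₀…v w…q_n in G* forces i < j, while the walk τ(q₀…w) τ(v…p_n) in T*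
--     forces j ≤ i.
module Submission where

open import Defs
open import Data.Nat using (ℕ; zero; suc; _+_; _≤_; _<_)
open import Data.Nat.Properties
  using (+-cancelˡ-≤; +-cancelʳ-≤; +-suc; <-irrefl; ≤⇒≯; +-0-monoid; +-commutativeSemigroup; 1+n≢n)
open import Data.Fin using (Fin; inject₁; fromℕ; toℕ) renaming (zero to fzero; suc to fsuc)
open import Data.Fin.Properties using (_≟_; toℕ-inject₁)
open import Data.Bool using (true; false; _∧_; if_then_else_)
open import Data.List using (tabulate)
open import Data.List.Properties using (map-tabulate)
open import Data.Nat.ListAction using (sum)
open import Data.Product using (Σ; _×_; _,_; proj₁)
open import Data.Empty using (⊥; ⊥-elim)
open import Relation.Nullary using (yes; no)
open import Relation.Binary.PropositionalEquality
open import Function using (_∘_; id)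
open import Function.Definitions using (Injective)
open import Algebra.Properties.Monoid.Sum +-0-monoid using (sum-replicate-zero)
  renaming (sum to ∑)
open import Algebra.Properties.CommutativeSemigroup +-commutativeSemigroup using (interchange)

module _ {A : Set} {R : A → A → Set} where

  data Walk : A → A → ℕ → Set where
    ⟨⟩  : ∀ {x} → Walk x x 0
    _▸_ : ∀ {x y z n} → R x y → Walk y z n → Walk x z (suc n)

  infixr 5 _▸_ _⊕_

  _⊕_ : ∀ {x y z a b} → Walk x y a → Walk y z b → Walk x z (a + b)
  ⟨⟩      ⊕ W′ = W′
  (r ▸ W) ⊕ W′ = r ▸ (W ⊕ W′)

  vertex : ∀ {x y n} → Walk x y n → Fin (suc n) → A
  vertex {x = x} ⟨⟩      _        = x
  vertex {x = x} (r ▸ W) fzero    = x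
  vertex         (r ▸ W) (fsuc i) = vertex W i

  vertex-first : ∀ {x y n} (W : Walk x y n) → vertex W fzero ≡ x
  vertex-first ⟨⟩      = refl
  vertex-first (r ▸ W) = refl

  vertex-last : ∀ {x y n} (W : Walk x y n) → vertex W (fromℕ n) ≡ y
  vertex-last ⟨⟩      = refl
  vertex-last (r ▸ W) = vertex-last W

  vertex-step : ∀ {x y n} (W : Walk x y n) (i : Fin n) →
                R (vertex W (inject₁ i)) (vertex W (fsuc i))
  vertex-step {x = x} (r ▸ W) fzero    = subst (R x) (sym (vertex-first W)) r
  vertex-step         (r ▸ W) (fsuc i) = vertex-step W i

  prefix : ∀ {x y n} (W : Walk x y n) (k : Fin (suc n)) → Walk x (vertex W k) (toℕ k)
  prefix ⟨⟩      fzero    = ⟨⟩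
  prefix (r ▸ W) fzero    = ⟨⟩
  prefix (r ▸ W) (fsuc k) = r ▸ prefix W k

  Chain : (n : ℕ) → (Fin (suc n) → A) → Set
  Chain n f = ∀ (i : Fin n) → R (f (inject₁ i)) (f (fsuc i))

  chain→walk : ∀ n f → Chain n f → Walk (f fzero) (f (fromℕ n)) n
  chain→walk zero    f st = ⟨⟩
  chain→walk (suc n) f st = st fzero ▸ chain→walk n (f ∘ fsuc) (st ∘ fsuc)

  split-at-vertex : ∀ n f → Chain n f → (k : Fin (suc n)) →
    Σ ℕ λ m → Walk (f fzero) (f k) (toℕ k) × Walk (f k) (f (fromℕ n)) m × toℕ k + m ≡ n
  split-at-vertex n       f st fzero    = n , ⟨⟩ , chain→walk n f st , refl
  split-at-vertex (suc n) f st (fsuc k) with split-at-vertex n (f ∘ fsuc) (st ∘ fsuc) k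
  ... | m , W₁ , W₂ , k+m≡n = m , st fzero ▸ W₁ , W₂ , cong suc k+m≡n

  split-at-step : ∀ n f → Chain n f → (i : Fin n) →
    Σ ℕ λ m → Walk (f fzero) (f (inject₁ i)) (toℕ i)
            × Walk (f (fsuc i)) (f (fromℕ n)) m × toℕ i + suc m ≡ n
  split-at-step (suc n) f st fzero    = n , ⟨⟩ , chain→walk n (f ∘ fsuc) (st ∘ fsuc) , refl
  split-at-step (suc n) f st (fsuc i) with split-at-step n (f ∘ fsuc) (st ∘ fsuc) i
  ... | m , W₁ , W₂ , i+1+m≡n = m , st fzero ▸ W₁ , W₂ , cong suc i+1+m≡n

map-walk : ∀ {A B : Set} {R : A → A → Set} {S : B → B → Set} (f : A → B) →
           (∀ x y → R x y → S (f x) (f y)) →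
           ∀ {x y n} → Walk {R = R} x y n → Walk {R = S} (f x) (f y) n
map-walk f pres ⟨⟩      = ⟨⟩
map-walk f pres (r ▸ W) = pres _ _ r ▸ map-walk f pres W

Walk* : (H : Digraph) → V H → V H → ℕ → Set
Walk* H = Walk {R = Arc* H}

closed-walk→cycle : ∀ {H x k} → Walk* H x x (suc k) → Cycle* H
closed-walk→cycle {k = k} W = record
  { k = k ; c = vertex W ; steps = vertex-step W
  ; close = trans (vertex-first W) (sym (vertex-last W)) }

-- In an acyclic digraph a walk of non-loop arcs never revisits a vertex: a repetition
-- would close a cycle through the first vertex.
walk*-injective : ∀ {H} → Acyclic H → ∀ {x y n} (W : Walk* H x y n) → Injective _≡_ _≡_ (vertex W)
walk*-injective ac ⟨⟩      {fzero}  {fzero}  _ = refl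
walk*-injective ac (r ▸ W) {fzero}  {fzero}  _ = refl
walk*-injective ac (r ▸ W) {fsuc a} {fsuc b} e = cong fsuc (walk*-injective ac W e)
walk*-injective {H} ac (_▸_ {y = y} r W) {fzero} {fsuc b} e =
  ⊥-elim (ac (closed-walk→cycle (r ▸ subst (λ z → Walk* H y z (toℕ b)) (sym e) (prefix W b))))
walk*-injective {H} ac (_▸_ {y = y} r W) {fsuc a} {fzero} e =
  ⊥-elim (ac (closed-walk→cycle (r ▸ subst (λ z → Walk* H y z (toℕ a)) e (prefix W a))))

walk*→path : ∀ {H} → Acyclic H → ∀ {x y ℓ} → Walk* H x y ℓ → Path H ℓ
walk*→path ac W = record
  { P = vertex W ; inj = walk*-injective ac W ; steps = λ i → proj₁ (vertex-step W i) }

walk*-length≤height : ∀ {H h} → Acyclic H → HeightIs H h → ∀ {x y ℓ} → Walk* H x y ℓ → ℓ ≤ h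
walk*-length≤height ac (_ , longest) W = longest _ (walk*→path ac W)

inject₁≢fsuc : ∀ {n} (i : Fin n) → inject₁ i ≢ fsuc i
inject₁≢fsuc i e = 1+n≢n (sym (trans (sym (toℕ-inject₁ i)) (cong toℕ e)))

path-chain* : ∀ {H ℓ} (p : Path H ℓ) → Chain {R = Arc* H} ℓ (P p)
path-chain* p i = steps p i , λ e → inject₁≢fsuc i (inj p e)

no-2-cycle : ∀ {H} → Acyclic H → ∀ {a b} → a ≢ b → Arc H a b → Arc H b a → ⊥
no-2-cycle ac a≢b ab ba = ac (closed-walk→cycle ((ab , a≢b) ▸ (ba , a≢b ∘ sym) ▸ ⟨⟩))

δ : ∀ {m} → Fin m → Fin m → ℕ
δ fzero    fzero    = 1
δ fzero    (fsuc _) = 0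
δ (fsuc _) fzero    = 0
δ (fsuc t) (fsuc u) = δ t u

δ-self : ∀ {m} (t : Fin m) → δ t t ≡ 1
δ-self fzero    = refl
δ-self (fsuc t) = δ-self t

δ-other : ∀ {m} {t u : Fin m} → u ≢ t → δ t u ≡ 0
δ-other {t = fzero}  {fzero}  u≢t = ⊥-elim (u≢t refl)
δ-other {t = fzero}  {fsuc u} u≢t = refl
δ-other {t = fsuc t} {fzero}  u≢t = refl
δ-other {t = fsuc t} {fsuc u} u≢t = δ-other (u≢t ∘ cong fsuc)

∑-δ : ∀ {m} (t : Fin m) → ∑ (δ t) ≡ 1
∑-δ {suc m} fzero    = cong suc (sum-replicate-zero m)
∑-δ         (fsuc t) = ∑-δ t

∑-cong : ∀ {m} {f g : Fin m → ℕ} → (∀ u → f u ≡ g u) → ∑ f ≡ ∑ g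
∑-cong {zero}  f≗g = refl
∑-cong {suc m} f≗g = cong₂ _+_ (f≗g fzero) (∑-cong (f≗g ∘ fsuc))

∑-+ : ∀ {m} (f g : Fin m → ℕ) → ∑ (λ u → f u + g u) ≡ ∑ f + ∑ g
∑-+ {zero}  f g = refl
∑-+ {suc m} f g = trans (cong (f fzero + g fzero +_) (∑-+ (f ∘ fsuc) (g ∘ fsuc)))
                        (interchange (f fzero) (g fzero) _ _)

between : (H : Digraph) → V H → V H → V H → ℕ
between H v u w = if arc H v u ∧ arc H u w then 1 else 0

between-arcs : ∀ (H : Digraph) {v u w} → Arc H v u → Arc H u w → between H v u w ≡ 1
between-arcs H vu uw rewrite vu | uw = refl

-- ι is defined through list sums; we work with the functional-vector sum ∑ instead.
sum-tabulate : ∀ {m} (f : Fin m → ℕ) → sum (tabulate f) ≡ ∑ f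
sum-tabulate {zero}  f = refl
sum-tabulate {suc m} f = cong (f fzero +_) (sum-tabulate (f ∘ fsuc))

ι-as-sum : ∀ (H : Digraph) v w → ι H v w ≡ ∑ (λ u → between H v u w)
ι-as-sum H v w = trans (cong sum (map-tabulate id (λ u → between H v u w)))
                       (sum-tabulate (λ u → between H v u w))

module Counting (T : Digraph) (acT : Acyclic T) (reflT : Reflexive T) where

  -- The only vertex between t and itself is t (loops exist, 2-cycles do not).
  loop-indicator : ∀ t u → between T t u t ≡ δ t u
  loop-indicator t u with u ≟ t
  ... | yes refl = trans (between-arcs T (reflT t) (reflT t)) (sym (δ-self t))
  ... | no u≢t with arc T t u in tu | arc T u t in ut
  ...   | false | _     = sym (δ-other u≢t)
  ...   | true  | false = sym (δ-other u≢t)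
  ...   | true  | true  = ⊥-elim (no-2-cycle acT (u≢t ∘ sym) tu ut)

  ι-loop : ∀ t → ι T t t ≡ 1
  ι-loop t = trans (ι-as-sum T t t) (trans (∑-cong (loop-indicator t)) (∑-δ t))

  NoMiddle : V T → V T → Set
  NoMiddle a b = ∀ u → u ≢ a → u ≢ b → Arc T a u → Arc T u b → ⊥

  arc-indicator : ∀ {a b} → Arc* T a b → NoMiddle a b → ∀ u → between T a u b ≡ δ a u + δ b u
  arc-indicator {a} {b} (ab , a≢b) gap u with u ≟ a
  ... | yes refl = trans (between-arcs T (reflT a) ab) (sym (cong₂ _+_ (δ-self a) (δ-other a≢b)))
  ... | no u≢a with u ≟ b
  ...   | yes refl = trans (between-arcs T ab (reflT b)) (sym (cong₂ _+_ (δ-other u≢a) (δ-self b)))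
  ...   | no u≢b with arc T a u in au | arc T u b in ub
  ...     | false | _     = sym (cong₂ _+_ (δ-other u≢a) (δ-other u≢b))
  ...     | true  | false = sym (cong₂ _+_ (δ-other u≢a) (δ-other u≢b))
  ...     | true  | true  = ⊥-elim (gap u u≢a u≢b au ub)

  ι-arc : ∀ {a b} → Arc* T a b → NoMiddle a b → ι T a b ≡ 2
  ι-arc {a} {b} ab gap = begin
    ι T a b                   ≡⟨ ι-as-sum T a b ⟩
    ∑ (λ u → between T a u b) ≡⟨ ∑-cong (arc-indicator ab gap) ⟩
    ∑ (λ u → δ a u + δ b u)   ≡⟨ ∑-+ (δ a) (δ b) ⟩
    ∑ (δ a) + ∑ (δ b)         ≡⟨ cong₂ _+_ (∑-δ a) (∑-δ b) ⟩
    2                         ∎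
    where open ≡-Reasoning

  -- In T of height n, an arc ab of T* lying on a walk of length n has nothing in between:
  -- a middle vertex would lengthen that walk to n + 1.
  no-middle-on-longest : ∀ {n} → HeightIs T n →
    ∀ {x a b y l₁ l₂} → Walk* T x a l₁ → Walk* T b y l₂ → l₁ + suc l₂ ≡ n → NoMiddle a b
  no-middle-on-longest hT {l₁ = l₁} {l₂} W₁ W₂ e u u≢a u≢b au ub =
    <-irrefl refl (+-cancelˡ-≤ l₁ (suc (suc l₂)) (suc l₂) (subst (l₁ + suc (suc l₂) ≤_) (sym e)
      (walk*-length≤height acT hT (W₁ ⊕ (au , u≢a ∘ sym) ▸ (ub , u≢b) ▸ W₂))))

module LongestPaths (n : ℕ) (T G : Digraph) (acT : Acyclic T) (reflT : Reflexive T)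
                    (hT : HeightIs T n) where
  open Counting T acT reflT

  ι-on-longest-paths : (σ : V G → V T) → IsHom* G T σ → (p : Path G n) (i : Fin n) →
                       ι T (σ (P p (inject₁ i))) (σ (P p (fsuc i))) ≡ 2
  ι-on-longest-paths σ σ* p i with split-at-step n (P p) (path-chain* p) i
  ... | m , W₁ , W₂ , e = ι-arc (σ* _ _ (path-chain* p i))
    (no-middle-on-longest hT (map-walk σ σ* W₁) (map-walk σ σ* W₂) e)

  -- If ι = 2 on an arc's image, that image is not a loop, since ι(t,t) = 1.
  ι≡2⇒distinct : ∀ {s t} → ι T s t ≡ 2 → s ≢ t
  ι≡2⇒distinct {s} ι≡2 refl with trans (sym (ι-loop s)) ι≡2
  ... | ()

  longest-paths-suffice : Acyclic G → HeightIs G n →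
    (∀ v → Σ (Path G n) λ p → Σ (Fin (suc n)) λ i → P p i ≡ v) →
    (τ : V G → V T) → IsHom G T τ →
    (∀ (p : Path G n) i → τ (P p (inject₁ i)) ≢ τ (P p (fsuc i))) → IsHom* G T τ
  longest-paths-suffice acG hG cover τ τh distinct v w (vw , v≢w) = τh v w vw , collapse⇒⊥
    where
    image-chain : ∀ (p : Path G n) → Chain {R = Arc* T} n (τ ∘ P p)
    image-chain p i = τh _ _ (steps p i) , distinct p i

    collapse⇒⊥ : τ v ≢ τ w
    collapse⇒⊥ τv≡τw with cover v | cover w
    ... | p , i , pᵢ≡v | q , j , qⱼ≡w
      with split-at-vertex n (P p) (path-chain* p) i | split-at-vertex n (P q) (path-chain* q) j
         | split-at-vertex n (τ ∘ P q) (image-chain q) j | split-at-vertex n (τ ∘ P p) (image-chain p) i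
    ... | _ , p₀⋯v , _ , _ | m , _ , w⋯qₙ , j+m≡n
        | _ , τq₀⋯τw , _ , _ | m′ , _ , τv⋯τpₙ , i+m′≡n = ≤⇒≯ j≤i i<j
      where
      -- p₀ ⋯ v → w ⋯ qₙ is a walk in G* of length i + 1 + m ≤ n = j + m.
      i<j : toℕ i < toℕ j
      i<j = +-cancelʳ-≤ m (suc (toℕ i)) (toℕ j) (subst₂ _≤_ (+-suc (toℕ i) m) (sym j+m≡n)
        (walk*-length≤height acG hG
          (subst (λ z → Walk* G (P p fzero) z (toℕ i)) pᵢ≡v p₀⋯v
           ⊕ (vw , v≢w) ▸ subst (λ z → Walk* G z (P q (fromℕ n)) m) qⱼ≡w w⋯qₙ)))

      τw≡τpᵢ : τ (P q j) ≡ τ (P p i)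
      τw≡τpᵢ = trans (cong τ qⱼ≡w) (trans (sym τv≡τw) (cong τ (sym pᵢ≡v)))

      -- τq₀ ⋯ τw = τv ⋯ τpₙ is a walk in T* of length j + m′ ≤ n = i + m′.
      j≤i : toℕ j ≤ toℕ i
      j≤i = +-cancelʳ-≤ m′ (toℕ j) (toℕ i) (subst (toℕ j + m′ ≤_) (sym i+m′≡n)
        (walk*-length≤height acT hT
          (subst (λ z → Walk* T (τ (P q fzero)) z (toℕ j)) τw≡τpᵢ τq₀⋯τw ⊕ τv⋯τpₙ)))

corollary6 : (n : ℕ) (T G : Digraph) → InR n T → InTah n G → HeightIs G n → HeightIs T n →
    (ρ : V G → V T) → IsS G T ρ →
    (τ : V G → V T) → (IsS G T τ → InJ G T n ρ τ) × (InJ G T n ρ τ → IsS G T τ)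
corollary6 n T G (acT , reflT , _) (acG , _ , cover) hG hT ρ (_ , ρ*) τ = S⊆J , J⊆S
  where
  open LongestPaths n T G acT reflT hT

  -- Both τ and ρ have ι = 2 on all longest-path arcs.
  S⊆J : IsS G T τ → InJ G T n ρ τ
  S⊆J (τh , τ*) = τh , λ p i →
    trans (ι-on-longest-paths τ τ* p i) (sym (ι-on-longest-paths ρ ρ* p i))

  -- τ inherits ι = 2 from ρ, hence keeps longest-path arcs non-loops.
  J⊆S : InJ G T n ρ τ → IsS G T τ
  J⊆S (τh , ι-agree) = τh , longest-paths-suffice acG hG cover τ τh λ p i →
    ι≡2⇒distinct (trans (ι-agree p i) (ι-on-longest-paths ρ ρ* p i))
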